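{- Let $\mathbb{F}$ be a field, $I\in\mathrm{Hilb}_n^d$, $\prec$ any monomial order, and $\lambda$ the initial staircase of $I$ with $I_\lambda=\mathrm{in}_\prec(I)$. Let $\mu$ be any basic set of $I$. Write $\lambda=\{\lambda_1,\dots,\lambda_n\}$ and $\mu=\{\mu_1,\dots,\mu_n\}$ with $\lambda_1\prec\dots\prec\lambda_n$ and $\mu_1\prec\dots\prec\mu_n$. Then $\lambda_k\preceq\mu_k$ for each $k=1,\dots,n$.
   Context: $\mathrm{Hilb}_n^d$ is the set of ideals $I\subseteq\mathbb{F}[x_1,\dots,x_d]$ with $\dim_{\mathbb{F}}\mathbb{F}[x]/I=n$; $x^v=\prod x_i^{v_i}$, and monomial orders are regarded as orders on $\mathbb{N}^d$. A staircase is $\lambda\subseteq\mathbb{N}^d$ with $u\le v\in\lambda\Rightarrow u\in\lambda$; $I_\lambda$ is the ideal generated by $x^v$ for $v$ minimal in $\mathbb{N}^d\setminus\lambda$. An $n$-subset $\mu\subset\mathbb{N}^d$ is a basic set of $I$ if the classes modulo $I$ of $x^v$, $v\in\mu$, form an $\mathbb{F}$-basis of $\mathbb{F}[x]/I$. -}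

module Defs where

open import Level using (Level; _⊔_; suc)
open import Data.Nat as ℕ using (ℕ)
open import Data.Fin as Fin using (Fin)
open import Data.Sum using (_⊎_)
open import Level using (Lift)
open import Data.Product using (Σ; _×_; _,_)
open import Data.List using (List; []; _∷_; _++_; map; concatMap; foldr)
open import Data.Vec as Vec using (Vec; zipWith; lookup; toList)
open import Data.Vec.Properties using (≡-dec)
open import Relation.Nullary using (¬_; yes; no)
open import Relation.Binary.PropositionalEquality using (_≡_)
open import Relation.Binary.Structures using (IsStrictTotalOrder)
open import Induction.WellFounded using (WellFounded)
open import Algebra.Bundles using (CommutativeRing)

record Field (c ℓ : Level) : Set (suc (c ⊔ ℓ)) where
  field
    commutativeRing : CommutativeRing c ℓ
  open CommutativeRing commutativeRing public
  field
    1≉0     : ¬ (1# ≈ 0#)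
    inverse : ∀ x → ¬ (x ≈ 0#) → Σ Carrier (λ y → (x * y) ≈ 1#)

module WithField {c ℓ : Level} (F : Field c ℓ) (d : ℕ) where
  open Field F

  Mono : Set
  Mono = Vec ℕ d

  _+ᵐ_ : Mono → Mono → Mono
  _+ᵐ_ = zipWith ℕ._+_

  -- polynomials in F[x₁,…,x_d] as formal finite sums of terms c·x^v
  Poly : Set c
  Poly = List (Carrier × Mono)

  coeff : Poly → Mono → Carrier
  coeff [] v = 0#
  coeff ((a , w) ∷ p) v with ≡-dec ℕ._≟_ w v
  ... | yes _ = a + coeff p v
  ... | no  _ = coeff p v

  _≈ₚ_ : Poly → Poly → Set ℓ
  p ≈ₚ q = ∀ v → coeff p v ≈ coeff q v

  0ₚ : Poly
  0ₚ = []

  _+ₚ_ : Poly → Poly → Poly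
  _+ₚ_ = _++_

  scale : Carrier → Poly → Poly
  scale a = map (λ { (b , w) → (a * b , w) })

  -ₚ_ : Poly → Poly
  -ₚ_ = map (λ { (b , w) → (- b , w) })

  _*ₚ_ : Poly → Poly → Poly
  p *ₚ q = concatMap (λ { (a , v) → map (λ { (b , w) → (a * b , v +ᵐ w) }) q }) p

  monomial : Mono → Poly
  monomial v = (1# , v) ∷ []

  record IsIdeal {ℓ′ : Level} (I : Poly → Set ℓ′) : Set (c ⊔ ℓ ⊔ ℓ′) where
    field
      resp   : ∀ {p q} → p ≈ₚ q → I p → I q
      zero∈  : I 0ₚ
      +-closed : ∀ {p q} → I p → I q → I (p +ₚ q)
      *-closed : ∀ r {p} → I p → I (r *ₚ p)

  linComb : ∀ {n} → Vec Carrier n → Vec Poly n → Poly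
  linComb cs bs = foldr _++_ [] (toList (zipWith scale cs bs))

  -- the classes of b₁,…,b_n modulo I form an F-basis of F[x]/I
  IsBasisMod : ∀ {ℓ′ n} → (Poly → Set ℓ′) → Vec Poly n → Set (c ⊔ ℓ ⊔ ℓ′)
  IsBasisMod I bs =
    (∀ cs → I (linComb cs bs) → ∀ i → lookup cs i ≈ 0#)
    × (∀ p → Σ (Vec Carrier _) (λ cs → I (p +ₚ (-ₚ linComb cs bs))))

  -- I ∈ Hilb_n^d : I is an ideal with dim_F F[x]/I = n
  InHilb : ∀ {ℓ′} → (Poly → Set ℓ′) → ℕ → Set (c ⊔ ℓ ⊔ ℓ′)
  InHilb I n = IsIdeal I × Σ (Vec Poly n) (IsBasisMod I)

  IsBasicSet : ∀ {ℓ′ n} → (Poly → Set ℓ′) → Vec Mono n → Set (c ⊔ ℓ ⊔ ℓ′)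
  IsBasicSet I μ = IsBasisMod I (Vec.map monomial μ)

  record MonomialOrder (r : Level) : Set (Level.suc r) where
    field
      _≺_        : Mono → Mono → Set r
      isSTO      : IsStrictTotalOrder _≡_ _≺_
      compatible : ∀ u v w → u ≺ v → (u +ᵐ w) ≺ (v +ᵐ w)
      wellFounded : WellFounded _≺_

    _≼_ : Mono → Mono → Set r
    u ≼ v = (u ≺ v) ⊎ Lift r (u ≡ v)

  module _ {r : Level} (ord : MonomialOrder r) where
    open MonomialOrder ord

    LeadExp : Poly → Mono → Set (ℓ ⊔ r)
    LeadExp p v = ¬ (coeff p v ≈ 0#) × (∀ w → v ≺ w → coeff p w ≈ 0#)

    -- the initial staircase λ of I: exponents v with x^v ∉ in_≺(I),
    -- i.e. v is not the leading exponent of any element of I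
    InInitialStaircase : ∀ {ℓ′} → (Poly → Set ℓ′) → Mono → Set (c ⊔ ℓ ⊔ ℓ′ ⊔ r)
    InInitialStaircase I v = ¬ Σ Poly (λ p → I p × LeadExp p v)

    StrictlyIncreasing : ∀ {n} → Vec Mono n → Set r
    StrictlyIncreasing {n} vs = ∀ (i j : Fin n) → i Fin.< j → lookup vs i ≺ lookup vs j

module Submission where

-- Suppose λₖ ≻ μₖ. Then x^μ₁, …, x^μₖ are k monomials below λₖ, linearly independent
-- modulo I. But modulo I the polynomials supported below a monomial b span a space of
-- dimension at most #{i : λᵢ ≺ b}, which is k − 1 for b = λₖ. The bound is proved by Gaussian
-- elimination, by well-founded induction on b: let v be the greatest exponent below b
-- occurring in an independent family. If every member vanishes at v, pass to v.
-- Otherwise v lies in the staircase, for if some q ∈ I had leading exponent v, subtracting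
-- multiples of q would clear v and keep the family independent; so v = λᵢ, and a member
-- with nonzero v-coefficient is used as a pivot to clear v from the others and dropped,
-- leaving one polynomial fewer and only i staircase elements below v.

open import Defs
open import Level using (Level; lift; _⊔_)
open import Data.Nat as ℕ using (ℕ; zero; suc; _≤_; _<_; z≤n; s≤s)
import Data.Nat.Properties as ℕ
open import Data.Fin as Fin using (Fin; zero; suc; toℕ; inject≤; punchIn)
import Data.Fin.Properties as Fin
open import Data.Product using (_×_; ∃; _,_; proj₂)
open import Data.Sum as Sum using (_⊎_; inj₁; inj₂)
open import Data.Empty using (⊥; ⊥-elim)
open import Data.List as List using (List; []; _∷_; _++_)
open import Data.List.Membership.Propositional using () renaming (_∈_ to _∈ˡ_)
open import Data.List.Membership.Propositional.Properties using (∈-++⁺ˡ; ∈-++⁺ʳ)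
open import Data.List.Relation.Unary.Any using (here; there)
import Data.List.Properties as List
open import Data.Vec as Vec using (Vec; []; _∷_; lookup; tabulate)
import Data.Vec.Properties as Vec
open import Data.Vec.Functional using (Vector; insertAt; removeAt)
import Data.Vec.Functional.Properties as Vector
open import Data.Vec.Membership.Propositional using (_∈_)
import Data.Vec.Relation.Unary.Any as VecAny
import Data.Vec.Relation.Unary.Any.Properties as VecAny
open import Function using (_∘_; _⇔_; Equivalence)
open import Induction.WellFounded using (Acc; acc)
open import Relation.Nullary using (¬_; yes; no)
open import Relation.Nullary.Decidable using (¬¬-excluded-middle)
open import Relation.Binary.Definitions using (tri<; tri≈; tri>)
open import Relation.Binary.Structures using (IsStrictTotalOrder)
open import Relation.Binary.PropositionalEquality as ≡ using (_≡_; _≢_; _≗_)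
import Algebra.Properties.Ring as RingProperties

¬¬-∀⊎∃¬ : ∀ {p m} (P : Fin m → Set p) → ¬ ¬ ((∀ i → P i) ⊎ ∃ λ i → ¬ P i)
¬¬-∀⊎∃¬ {m = zero}  P k = k (inj₁ λ ())
¬¬-∀⊎∃¬ {m = suc m} P k = ¬¬-excluded-middle λ
  { (no ¬P₀) → k (inj₂ (zero , ¬P₀))
  ; (yes P₀) → ¬¬-∀⊎∃¬ (P ∘ suc) λ
      { (inj₁ ∀P) → k (inj₁ λ { zero → P₀ ; (suc i) → ∀P i })
      ; (inj₂ (i , ¬Pᵢ)) → k (inj₂ (suc i , ¬Pᵢ)) } }

module StrictTotalOrderProperties {a r} {A : Set a} {_<_ : A → A → Set r}
  (isSTO : IsStrictTotalOrder _≡_ _<_) where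
  open IsStrictTotalOrder isSTO

  greatest-below : (xs : List A) (b : A) →
    (∀ x → x ∈ˡ xs → ¬ x < b) ⊎ ∃ λ v → v < b × (∀ x → x ∈ˡ xs → x < b → ¬ v < x)
  greatest-below [] b = inj₁ λ _ ()
  greatest-below (x ∷ xs) b with greatest-below xs b | x <? b
  ... | inj₁ none | no x≮b = inj₁ λ { _ (here ≡.refl) → x≮b ; y (there y∈) → none y y∈ }
  ... | inj₁ none | yes x<b =
    inj₂ (x , x<b , λ { _ (here ≡.refl) _ → irrefl ≡.refl ; y (there y∈) y<b → ⊥-elim (none y y∈ y<b) })
  ... | inj₂ (v , v<b , top) | no x≮b =
    inj₂ (v , v<b , λ { _ (here ≡.refl) x<b → ⊥-elim (x≮b x<b) ; y (there y∈) → top y y∈ })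
  ... | inj₂ (v , v<b , top) | yes x<b with compare v x
  ...   | tri< v<x _ _ =
    inj₂ (x , x<b , λ { _ (here ≡.refl) _ → irrefl ≡.refl
                      ; y (there y∈) y<b x<y → top y y∈ y<b (trans v<x x<y) })
  ...   | tri≈ _ v≡x _ = inj₂ (v , v<b , λ { _ (here ≡.refl) _ → irrefl v≡x ; y (there y∈) → top y y∈ })
  ...   | tri> _ _ x<v = inj₂ (v , v<b , λ { _ (here ≡.refl) _ → asym x<v ; y (there y∈) → top y y∈ })

  module _ {n} (xs : Vec A n) (increasing : ∀ i j → i Fin.< j → lookup xs i < lookup xs j) where

    increasing-reflects-< : ∀ i j → lookup xs i < lookup xs j → i Fin.< j
    increasing-reflects-< i j xᵢ<xⱼ with ℕ.<-cmp (toℕ i) (toℕ j)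
    ... | tri< i<j _ _ = i<j
    ... | tri≈ _ i≡j _ = ⊥-elim (irrefl (≡.cong (lookup xs) (Fin.toℕ-injective i≡j)) xᵢ<xⱼ)
    ... | tri> _ _ j<i = ⊥-elim (asym xᵢ<xⱼ (increasing j i j<i))

    increasing-prefix-< : ∀ {b} k (j : Fin (suc (toℕ k))) →
      lookup xs k < b → lookup xs (inject≤ j (Fin.toℕ<n k)) < b
    increasing-prefix-< k j xₖ<b
      with ℕ.m≤n⇒m<n∨m≡n (≡.subst (ℕ._≤ toℕ k) (≡.sym (Fin.toℕ-inject≤ j _)) (Fin.toℕ≤pred[n] j))
    ... | inj₁ j<k = trans (increasing _ k j<k) xₖ<b
    ... | inj₂ j≡k = ≡.subst (λ i → lookup xs i < _) (≡.sym (Fin.toℕ-injective j≡k)) xₖ<b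

module IndependenceModuloIdeal {c ℓ : Level} (F : Field c ℓ) (d : ℕ) where
  open Field F hiding (zero)
  open WithField F d
  open import Algebra.Properties.Semiring.Sum semiring
  open import Relation.Binary.Reasoning.Setoid setoid

  coeff-+ₚ : ∀ p q w → coeff (p +ₚ q) w ≈ coeff p w + coeff q w
  coeff-+ₚ [] q w = sym (+-identityˡ _)
  coeff-+ₚ ((a , u) ∷ p) q w with Vec.≡-dec ℕ._≟_ u w
  ... | yes _ = trans (+-congˡ (coeff-+ₚ p q w)) (sym (+-assoc _ _ _))
  ... | no _ = coeff-+ₚ p q w

  coeff-scale : ∀ a p w → coeff (scale a p) w ≈ a * coeff p w
  coeff-scale a [] w = sym (zeroʳ a)
  coeff-scale a ((b , u) ∷ p) w with Vec.≡-dec ℕ._≟_ u w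
  ... | yes _ = trans (+-congˡ (coeff-scale a p w)) (sym (distribˡ a b _))
  ... | no _ = coeff-scale a p w

  coeff-addMultiple : ∀ h a q w → coeff (h +ₚ scale a q) w ≈ coeff h w + a * coeff q w
  coeff-addMultiple h a q w = trans (coeff-+ₚ h (scale a q) w) (+-congˡ (coeff-scale a q w))

  constant : Carrier → Poly
  constant a = (a , Vec.replicate d 0) ∷ []

  constant-*ₚ : ∀ a p → constant a *ₚ p ≡ scale a p
  constant-*ₚ a p = ≡.trans (List.++-identityʳ _)
    (List.map-cong (λ { (b , w) → ≡.cong (a * b ,_) (Vec.zipWith-identityˡ (λ _ → ≡.refl) w) }) p)

  lincombCoeff : ∀ {m} → Vector Carrier m → Vector Poly m → Mono → Carrier
  lincombCoeff {m} cs g w = ∑[ i < m ] (cs i * coeff (g i) w)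

  coeff-linComb : ∀ {m} (cs : Vec Carrier m) bs w →
                  coeff (linComb cs bs) w ≈ lincombCoeff (lookup cs) (lookup bs) w
  coeff-linComb [] [] w = refl
  coeff-linComb (a ∷ cs) (b ∷ bs) w =
    trans (coeff-+ₚ (scale a b) (linComb cs bs) w) (+-cong (coeff-scale a b w) (coeff-linComb cs bs w))

  lincombCoeff-zero : ∀ {m} (g : Vector Poly m) w → lincombCoeff (λ _ → 0#) g w ≈ 0#
  lincombCoeff-zero {m} g w = trans (sum-cong-≋ (λ i → zeroˡ (coeff (g i) w))) (sum-replicate-zero m)

  lincombCoeff-addMultiples : ∀ {m} (cs : Vector Carrier m) g (β : Vector Carrier m) q w →
    lincombCoeff cs (λ i → g i +ₚ scale (β i) q) w
      ≈ lincombCoeff cs g w + (∑[ i < m ] (cs i * β i)) * coeff q w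
  lincombCoeff-addMultiples {m} cs g β q w = begin
    ∑[ i < m ] (cs i * coeff (g i +ₚ scale (β i) q) w)
      ≈⟨ sum-cong-≋ (λ i → *-congˡ (coeff-addMultiple (g i) (β i) q w)) ⟩
    ∑[ i < m ] (cs i * (coeff (g i) w + β i * coeff q w))
      ≈⟨ sum-cong-≋ (λ i → trans (distribˡ (cs i) _ _)
                                  (+-congˡ (sym (*-assoc (cs i) (β i) (coeff q w))))) ⟩
    ∑[ i < m ] (cs i * coeff (g i) w + cs i * β i * coeff q w)
      ≈⟨ ∑-distrib-+ (λ i → cs i * coeff (g i) w) (λ i → cs i * β i * coeff q w) ⟩
    lincombCoeff cs g w + ∑[ i < m ] (cs i * β i * coeff q w)
      ≈⟨ +-congˡ (sym (*-distribʳ-sum (coeff q w) (λ i → cs i * β i))) ⟩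
    lincombCoeff cs g w + (∑[ i < m ] (cs i * β i)) * coeff q w ∎

  lincombCoeff-insertAt : ∀ {m} (cs : Vector Carrier m) g p x w →
    lincombCoeff (insertAt cs p x) g w ≈ x * coeff (g p) w + lincombCoeff cs (removeAt g p) w
  lincombCoeff-insertAt cs g p x w = begin
    lincombCoeff (insertAt cs p x) g w
      ≈⟨ sum-remove {i = p} (λ i → insertAt cs p x i * coeff (g i) w) ⟩
    insertAt cs p x p * coeff (g p) w + lincombCoeff (removeAt (insertAt cs p x) p) (removeAt g p) w
      ≡⟨ ≡.cong₂ (λ y z → y * coeff (g p) w + z)
           (Vector.insertAt-lookup cs p x)
           (sum-cong-≗ (λ j → ≡.cong (_* coeff (removeAt g p j) w)
                                      (Vector.removeAt-insertAt cs p x j))) ⟩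
    x * coeff (g p) w + lincombCoeff cs (removeAt g p) w ∎

  x+yz+[-y]z≈x : ∀ x y z → x + y * z + - y * z ≈ x
  x+yz+[-y]z≈x x y z = begin
    x + y * z + - y * z    ≈⟨ +-congˡ (sym (-‿distribˡ-* y z)) ⟩
    x + y * z + - (y * z)  ≈⟨ +-assoc x _ _ ⟩
    x + (y * z + - (y * z)) ≈⟨ +-congˡ (-‿inverseʳ _) ⟩
    x + 0#                 ≈⟨ +-identityʳ x ⟩
    x ∎
    where open RingProperties ring using (-‿distribˡ-*)

  extendByZero : ∀ {m n} → m ≤ n → Vector Carrier m → Vector Carrier n
  extendByZero z≤n       cs _       = 0#
  extendByZero (s≤s m≤n) cs zero    = cs zero
  extendByZero (s≤s m≤n) cs (suc i) = extendByZero m≤n (cs ∘ suc) i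

  extendByZero-inject≤ : ∀ {m n} (m≤n : m ≤ n) cs j → extendByZero m≤n cs (inject≤ j m≤n) ≡ cs j
  extendByZero-inject≤ (s≤s m≤n) cs zero    = ≡.refl
  extendByZero-inject≤ (s≤s m≤n) cs (suc j) = extendByZero-inject≤ m≤n (cs ∘ suc) j

  lincombCoeff-extendByZero : ∀ {m n} (m≤n : m ≤ n) cs (g : Vector Poly n) w →
    lincombCoeff (extendByZero m≤n cs) g w ≈ lincombCoeff cs (λ j → g (inject≤ j m≤n)) w
  lincombCoeff-extendByZero z≤n       cs g w = lincombCoeff-zero g w
  lincombCoeff-extendByZero (s≤s m≤n) cs g w =
    +-congˡ (lincombCoeff-extendByZero m≤n (cs ∘ suc) (g ∘ suc) w)

  IndependentModulo : ∀ {ℓ′ m} → (Poly → Set ℓ′) → Vector Poly m → Set (c ⊔ ℓ ⊔ ℓ′)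
  IndependentModulo I g = ∀ cs q → I q → (∀ w → coeff q w ≈ lincombCoeff cs g w) → ∀ i → cs i ≈ 0#

  module _ {ℓ′} {I : Poly → Set ℓ′} where

    independent-inject≤ : ∀ {m n} {g : Vector Poly n} (m≤n : m ≤ n) →
      IndependentModulo I g → IndependentModulo I (λ j → g (inject≤ j m≤n))
    independent-inject≤ {g = g} m≤n independent cs q Iq q≈ j =
      ≡.subst (_≈ 0#) (extendByZero-inject≤ m≤n cs j)
        (independent (extendByZero m≤n cs) q Iq
          (λ w → trans (q≈ w) (sym (lincombCoeff-extendByZero m≤n cs g w))) (inject≤ j m≤n))

    independent-resp-≗ : ∀ {m} {g h : Vector Poly m} → g ≗ h →
      IndependentModulo I g → IndependentModulo I h
    independent-resp-≗ g≗h independent cs q Iq q≈ = independent cs q Iq λ w →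
      trans (q≈ w) (reflexive (sum-cong-≗ (λ i → ≡.cong (λ p → cs i * coeff p w) (≡.sym (g≗h i)))))

  module _ {ℓ′} {I : Poly → Set ℓ′} (isIdeal : IsIdeal I) where
    open IsIdeal isIdeal

    scale-closed : ∀ a {p} → I p → I (scale a p)
    scale-closed a {p} Ip = ≡.subst I (constant-*ₚ a p) (*-closed (constant a) Ip)

    isBasisMod⇒independent : ∀ {n} {bs : Vec Poly n} → IsBasisMod I bs → IndependentModulo I (lookup bs)
    isBasisMod⇒independent {bs = bs} (independent , _) cs q Iq q≈ i =
      ≡.subst (_≈ 0#) (Vec.lookup∘tabulate cs i) (independent (tabulate cs) (resp q≈linComb Iq) i)
      where
      q≈linComb : q ≈ₚ linComb (tabulate cs) bs
      q≈linComb w = trans (q≈ w) (sym (trans (coeff-linComb (tabulate cs) bs w)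
        (reflexive (sum-cong-≗ (λ i → ≡.cong (_* coeff (lookup bs i) w) (Vec.lookup∘tabulate cs i))))))

    independent-addMultiples : ∀ {m} {g : Vector Poly m} {q} (β : Vector Carrier m) →
      IndependentModulo I g → I q → IndependentModulo I (λ i → g i +ₚ scale (β i) q)
    independent-addMultiples {m} {g} {q} β independent Iq cs Q IQ Q≈ =
      independent cs (Q +ₚ scale (- D) q) (+-closed IQ (scale-closed (- D) Iq)) λ w → begin
        coeff (Q +ₚ scale (- D) q) w                          ≈⟨ coeff-addMultiple Q (- D) q w ⟩
        coeff Q w + - D * coeff q w
          ≈⟨ +-congʳ (trans (Q≈ w) (lincombCoeff-addMultiples cs g β q w)) ⟩
        lincombCoeff cs g w + D * coeff q w + - D * coeff q w ≈⟨ x+yz+[-y]z≈x _ D _ ⟩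
        lincombCoeff cs g w                                   ∎
      where
      D : Carrier
      D = ∑[ i < m ] (cs i * β i)

    independent-pivot : ∀ {m} {g : Vector Poly (suc m)} p (β : Vector Carrier (suc m)) →
      IndependentModulo I g → IndependentModulo I (removeAt (λ i → g i +ₚ scale (β i) (g p)) p)
    independent-pivot {m} {g} p β independent cs Q IQ Q≈ j =
      ≡.subst (_≈ 0#) (Vector.insertAt-punchIn cs p D j)
        (independent (insertAt cs p D) Q IQ Q≈′ (punchIn p j))
      where
      D : Carrier
      D = ∑[ j < m ] (cs j * β (punchIn p j))
      Q≈′ : ∀ w → coeff Q w ≈ lincombCoeff (insertAt cs p D) g w
      Q≈′ w = begin
        coeff Q w                                             ≈⟨ Q≈ w ⟩
        lincombCoeff cs (removeAt (λ i → g i +ₚ scale (β i) (g p)) p) w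
          ≈⟨ lincombCoeff-addMultiples cs (removeAt g p) (removeAt β p) (g p) w ⟩
        lincombCoeff cs (removeAt g p) w + D * coeff (g p) w ≈⟨ +-comm _ _ ⟩
        D * coeff (g p) w + lincombCoeff cs (removeAt g p) w ≈⟨ lincombCoeff-insertAt cs g p D w ⟨
        lincombCoeff (insertAt cs p D) g w                    ∎

    independent⇒member≉0 : ∀ {m} {g : Vector Poly (suc m)} → IndependentModulo I g →
      ∀ i → ¬ (∀ w → coeff (g i) w ≈ 0#)
    independent⇒member≉0 {g = g} independent i gᵢ≈0 =
      1≉0 (≡.subst (_≈ 0#) (Vector.insertAt-lookup _ i 1#)
        (independent (insertAt (λ _ → 0#) i 1#) 0ₚ zero∈ 0≈ i))
      where
      0≈ : ∀ w → 0# ≈ lincombCoeff (insertAt (λ _ → 0#) i 1#) g w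
      0≈ w = sym (begin
        lincombCoeff (insertAt (λ _ → 0#) i 1#) g w           ≈⟨ lincombCoeff-insertAt _ g i 1# w ⟩
        1# * coeff (g i) w + lincombCoeff (λ _ → 0#) (removeAt g i) w
          ≈⟨ +-cong (trans (*-identityˡ _) (gᵢ≈0 w)) (lincombCoeff-zero (removeAt g i) w) ⟩
        0# + 0#                                               ≈⟨ +-identityʳ 0# ⟩
        0#                                                    ∎)

  exponents : Poly → List Mono
  exponents = List.map proj₂

  exponentsOf : ∀ {m} → Vector Poly m → List Mono
  exponentsOf {zero}  g = []
  exponentsOf {suc m} g = exponents (g zero) ++ exponentsOf (g ∘ suc)

  coeff≈0⊎∈exponents : ∀ p w → coeff p w ≈ 0# ⊎ w ∈ˡ exponents p
  coeff≈0⊎∈exponents [] w = inj₁ refl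
  coeff≈0⊎∈exponents ((a , u) ∷ p) w with Vec.≡-dec ℕ._≟_ u w
  ... | yes u≡w = inj₂ (here (≡.sym u≡w))
  ... | no _    = Sum.map₂ there (coeff≈0⊎∈exponents p w)

  coeff≈0⊎∈exponentsOf : ∀ {m} (g : Vector Poly m) i w → coeff (g i) w ≈ 0# ⊎ w ∈ˡ exponentsOf g
  coeff≈0⊎∈exponentsOf g zero    w = Sum.map₂ ∈-++⁺ˡ (coeff≈0⊎∈exponents (g zero) w)
  coeff≈0⊎∈exponentsOf g (suc i) w = Sum.map₂ (∈-++⁺ʳ _) (coeff≈0⊎∈exponentsOf (g ∘ suc) i w)

  coeff-monomial-≢ : ∀ {u w} → u ≢ w → coeff (monomial u) w ≈ 0#
  coeff-monomial-≢ {u} {w} u≢w with Vec.≡-dec ℕ._≟_ u w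
  ... | yes u≡w = ⊥-elim (u≢w u≡w)
  ... | no _    = refl

  module _ {r} (ord : MonomialOrder r) where
    open MonomialOrder ord
    open IsStrictTotalOrder isSTO using (compare; _<?_)
    open StrictTotalOrderProperties isSTO

    SupportedBelow : Mono → Poly → Set (ℓ ⊔ r)
    SupportedBelow b h = ∀ w → ¬ w ≺ b → coeff h w ≈ 0#

    VanishesAbove : Mono → Poly → Set (ℓ ⊔ r)
    VanishesAbove v h = ∀ w → v ≺ w → coeff h w ≈ 0#

    monomial-supportedBelow : ∀ {u b} → u ≺ b → SupportedBelow b (monomial u)
    monomial-supportedBelow {u} u≺b w w⊀b = coeff-monomial-≢ {u} {w} λ { ≡.refl → w⊀b u≺b }

    vanishesAbove⇒supportedBelow : ∀ v h → VanishesAbove v h → coeff h v ≈ 0# → SupportedBelow v h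
    vanishesAbove⇒supportedBelow v h vanish hᵥ≈0 w w⊀v with compare w v
    ... | tri< w≺v _ _  = ⊥-elim (w⊀v w≺v)
    ... | tri≈ _ ≡.refl _ = hᵥ≈0
    ... | tri> _ _ v≺w  = vanish w v≺w

    vanishesAbove-addMultiple : ∀ {v h q} a → VanishesAbove v h → VanishesAbove v q →
      VanishesAbove v (h +ₚ scale a q)
    vanishesAbove-addMultiple {h = h} {q} a h-vanish q-vanish w v≺w = begin
      coeff (h +ₚ scale a q) w  ≈⟨ coeff-addMultiple h a q w ⟩
      coeff h w + a * coeff q w ≈⟨ +-cong (h-vanish w v≺w) (trans (*-congˡ (q-vanish w v≺w)) (zeroʳ a)) ⟩
      0# + 0#                   ≈⟨ +-identityʳ 0# ⟩
      0#                        ∎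

    eliminate : Mono → Carrier → Poly → Poly → Poly
    eliminate v inv q h = h +ₚ scale (- (coeff h v * inv)) q

    coeff-eliminate : ∀ {v inv q} h → coeff q v * inv ≈ 1# → coeff (eliminate v inv q h) v ≈ 0#
    coeff-eliminate {v} {inv} {q} h inverts = begin
      coeff (eliminate v inv q h) v         ≈⟨ coeff-addMultiple h _ q v ⟩
      hᵥ + - (hᵥ * inv) * coeff q v          ≈⟨ +-congˡ (sym (-‿distribˡ-* _ _)) ⟩
      hᵥ + - (hᵥ * inv * coeff q v)          ≈⟨ +-congˡ (-‿cong (*-assoc _ _ _)) ⟩
      hᵥ + - (hᵥ * (inv * coeff q v))        ≈⟨ +-congˡ (-‿cong (*-congˡ (trans (*-comm _ _) inverts))) ⟩
      hᵥ + - (hᵥ * 1#)                       ≈⟨ +-congˡ (-‿cong (*-identityʳ _)) ⟩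
      hᵥ + - hᵥ                              ≈⟨ -‿inverseʳ _ ⟩
      0#                                     ∎
      where
      open RingProperties ring using (-‿distribˡ-*)
      hᵥ : Carrier
      hᵥ = coeff h v

    eliminate-supportedBelow : ∀ v {inv} q h → coeff q v * inv ≈ 1# → VanishesAbove v q →
      VanishesAbove v h → SupportedBelow v (eliminate v inv q h)
    eliminate-supportedBelow v {inv} q h inverts q-vanish h-vanish =
      vanishesAbove⇒supportedBelow v (eliminate v inv q h)
        (vanishesAbove-addMultiple {v} {h} {q} _ h-vanish q-vanish)
        (coeff-eliminate {v} {inv} {q} h inverts)

    noExponentBelow⇒zero : ∀ b {m} (g : Vector Poly m) → (∀ w → w ∈ˡ exponentsOf g → ¬ w ≺ b) →
      ∀ i → SupportedBelow b (g i) → ∀ w → coeff (g i) w ≈ 0#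
    noExponentBelow⇒zero b g none i supported w with coeff≈0⊎∈exponentsOf g i w
    ... | inj₁ gᵢ≈0 = gᵢ≈0
    ... | inj₂ w∈   = supported w (none w w∈)

    greatestExponentBelow⇒vanishesAbove : ∀ b v {m} (g : Vector Poly m) →
      (∀ w → w ∈ˡ exponentsOf g → w ≺ b → ¬ v ≺ w) →
      ∀ i → SupportedBelow b (g i) → VanishesAbove v (g i)
    greatestExponentBelow⇒vanishesAbove b v g greatest i supported w v≺w
      with coeff≈0⊎∈exponentsOf g i w | w <? b
    ... | inj₁ gᵢ≈0 | _        = gᵢ≈0
    ... | inj₂ w∈   | yes w≺b = ⊥-elim (greatest w w∈ w≺b v≺w)
    ... | inj₂ _    | no w⊀b  = supported w w⊀b

    module _ {ℓ′} {I : Poly → Set ℓ′} (isIdeal : IsIdeal I) {n} {lam : Vec Mono n}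
      (lam-increasing : StrictlyIncreasing ord lam)
      (staircase⊆lam : ∀ v → InInitialStaircase ord I v → v ∈ lam) where
      open IsStrictTotalOrder isSTO using () renaming (trans to ≺-trans)

      -- As lam is strictly increasing, this says that at most t entries of lam lie below b.
      CountBelow≤ : Mono → ℕ → Set r
      CountBelow≤ b t = ∀ i → lookup lam i ≺ b → toℕ i < t

      DimensionBound : Mono → Set (c ⊔ ℓ ⊔ ℓ′ ⊔ r)
      DimensionBound b = ∀ {m} (g : Vector Poly m) t → IndependentModulo I g →
        (∀ i → SupportedBelow b (g i)) → CountBelow≤ b t → ¬ t < m

      countBelow-mono : ∀ {v b t} → v ≺ b → CountBelow≤ b t → CountBelow≤ v t
      countBelow-mono v≺b count i lamᵢ≺v = count i (≺-trans lamᵢ≺v v≺b)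

      greatest-inInitialStaircase : ∀ {v b m} → v ≺ b → DimensionBound v → (g : Vector Poly m) (t : ℕ) →
        IndependentModulo I g → (∀ i → VanishesAbove v (g i)) → CountBelow≤ b t → t < m →
        InInitialStaircase ord I v
      greatest-inInitialStaircase {v} v≺b bound g t independent vanish count t<m
        (q , Iq , qᵥ≉0 , q-vanish)
        with inverse (coeff q v) qᵥ≉0
      ... | inv , inverts =
        bound (λ i → eliminate v inv q (g i)) t
          (independent-addMultiples isIdeal {g = g} (λ i → - (coeff (g i) v * inv)) independent Iq)
          (λ i → eliminate-supportedBelow v q (g i) inverts q-vanish (vanish i))
          (countBelow-mono v≺b count) t<m

      pivot-absurd : ∀ {v b m} → v ≺ b → DimensionBound v → (g : Vector Poly (suc m)) (t : ℕ) →
        IndependentModulo I g → (∀ i → VanishesAbove v (g i)) → CountBelow≤ b t → t < suc m →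
        ∀ i → v ≡ lookup lam i → ∀ p → ¬ coeff (g p) v ≈ 0# → ⊥
      pivot-absurd {v} v≺b bound g t independent vanish count t<m i ≡.refl p gₚᵥ≉0
        with inverse (coeff (g p) v) gₚᵥ≉0
      ... | inv , inverts =
        bound (removeAt (λ j → eliminate v inv (g p) (g j)) p) (toℕ i)
          (independent-pivot isIdeal {g = g} p (λ j → - (coeff (g j) v * inv)) independent)
          (λ j → eliminate-supportedBelow v (g p) (g (punchIn p j))
                   inverts (vanish p) (vanish (punchIn p j)))
          (λ i′ → increasing-reflects-< lam lam-increasing i′ i)
          (ℕ.<-≤-trans (count i v≺b) (ℕ.≤-pred t<m))

      -- Equality of coefficients is not decidable; the case split on vanishing at v is
      -- made under ¬¬, which is harmless because the goal is ⊥.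
      greatest-bound : ∀ {v b m} → v ≺ b → DimensionBound v → (g : Vector Poly m) (t : ℕ) →
        IndependentModulo I g → (∀ i → VanishesAbove v (g i)) → CountBelow≤ b t → ¬ t < m
      greatest-bound {m = zero} _ _ _ _ _ _ _ ()
      greatest-bound {v} {m = suc m} v≺b bound g t independent vanish count t<m =
        ¬¬-∀⊎∃¬ (λ i → coeff (g i) v ≈ 0#) λ
          { (inj₁ gᵥ≈0) → bound g t independent
              (λ i → vanishesAbove⇒supportedBelow v (g i) (vanish i) (gᵥ≈0 i))
              (countBelow-mono v≺b count) t<m
          ; (inj₂ (p , gₚᵥ≉0)) → pivot-absurd v≺b bound g t independent vanish count t<m
              (VecAny.index v∈lam) (VecAny.lookup-index v∈lam) p gₚᵥ≉0 }
        where
        v∈lam : v ∈ lam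
        v∈lam = staircase⊆lam v (greatest-inInitialStaircase v≺b bound g t independent vanish count t<m)

      dimensionBound : ∀ b → Acc _≺_ b → DimensionBound b
      dimensionBound b _ {zero} _ _ _ _ _ ()
      dimensionBound b (acc below) {suc m} g t independent supported count t<m
        with greatest-below (exponentsOf g) b
      ... | inj₁ none =
        independent⇒member≉0 isIdeal {g = g} independent zero
          (noExponentBelow⇒zero b g none zero (supported zero))
      ... | inj₂ (v , v≺b , greatest) =
        greatest-bound v≺b (dimensionBound v (below v≺b)) g t independent
          (λ i → greatestExponentBelow⇒vanishesAbove b v g greatest i (supported i)) count t<m

      staircase-≼-independentMonomials : ∀ (mu : Vec Mono n) → StrictlyIncreasing ord mu →
        IndependentModulo I (monomial ∘ lookup mu) → ∀ k → lookup lam k ≼ lookup mu k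
      staircase-≼-independentMonomials mu mu-increasing independent k
        with compare (lookup lam k) (lookup mu k)
      ... | tri< lamₖ≺muₖ _ _ = inj₁ lamₖ≺muₖ
      ... | tri≈ _ lamₖ≡muₖ _ = inj₂ (lift lamₖ≡muₖ)
      ... | tri> _ _ muₖ≺lamₖ = ⊥-elim
        (dimensionBound (lookup lam k) (wellFounded _) prefix (toℕ k)
          (independent-inject≤ {g = monomial ∘ lookup mu} k<n independent)
          (λ j → monomial-supportedBelow (increasing-prefix-< mu mu-increasing k j muₖ≺lamₖ))
          (λ i → increasing-reflects-< lam lam-increasing i k) (ℕ.n<1+n (toℕ k)))
        where
        k<n : toℕ k < n
        k<n = Fin.toℕ<n k
        prefix : Vector Poly (suc (toℕ k))
        prefix j = monomial (lookup mu (inject≤ j k<n))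

proposition2p2 : ∀ {c ℓ ℓ′ r : Level} (F : Field c ℓ) (d n : ℕ)
    → let open WithField F d in
    (I : Poly → Set ℓ′) → InHilb I n
    → (ord : MonomialOrder r)
    → (lam mu : Vec Mono n)
    → StrictlyIncreasing ord lam
    → (∀ v → InInitialStaircase ord I v ⇔ v ∈ lam)
    → StrictlyIncreasing ord mu
    → IsBasicSet I mu
    → ∀ (k : Fin n) → MonomialOrder._≼_ ord (lookup lam k) (lookup mu k)
proposition2p2 F d n I (isIdeal , _) ord lam mu lam-increasing staircase mu-increasing basic =
  staircase-≼-independentMonomials ord isIdeal lam-increasing (λ v → Equivalence.to (staircase v))
    mu mu-increasing
    (independent-resp-≗ (λ i → Vec.lookup-map i (WithField.monomial F d) mu)
      (isBasisMod⇒independent isIdeal basic))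
  where open IndependenceModuloIdeal F d
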